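{- Fix an unordered pair $P$ of colors and let $c$ be a variety having $P$ as an opposite pair. Take four cubes of variety $c$ together with two cubes each of two further varieties $d\neq e$ that also have $P$ as an opposite pair, where $d,e\notin\{c,c^*\}$. Then these eight cubes can be assembled into a corner solution modeled on $c$. Similarly, six cubes of variety $c$ together with two further cubes having $P$ as an opposite pair, neither of which is of variety $c^*$, can be assembled into a corner solution modeled on $c$.
   Context: Fix a palette of six colors. A colored cube is a unit cube each face painted one color, all six colors appearing. Varieties are colored cubes up to rigid rotation; $c^*$ denotes the mirror image of $c$. An opposite pair is the unordered pair of colors on two opposite faces. A corner solution is a set of eight cubes arranged into a $2\times2\times2$ cube with each outer face monochromatic; it is modeled on $c$ if the resulting big cube has the coloring of variety $c$. -}

module Defs where

open import Data.Bool using (Bool; true; false; not; _xor_)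
open import Data.Fin using (Fin; zero; suc)
open import Data.Fin.Properties using (_≟_)
open import Data.Product using (Σ; ∃; _×_; _,_)
open import Data.Vec using (Vec; lookup; _∷_; [])
open import Function.Bundles using (_↔_; Inverse)
open import Function.Definitions using (Injective)
open import Relation.Binary.PropositionalEquality using (_≡_)
open import Relation.Nullary using (¬_)
open import Relation.Nullary.Decidable using (isYes)

Color : Set
Color = Fin 6

-- Geometry of a unit cube: the coordinate axes and the six faces.
-- Face (a , true) is the face with outward normal +e_a, (a , false) has normal -e_a.
Axis : Set
Axis = Fin 3

Face : Set
Face = Axis × Bool

opp : Face → Face
opp (a , s) = (a , not s)

Coloring : Set
Coloring = Face → Color

IsColoredCube : Coloring → Set
IsColoredCube c = (k : Color) → ∃ λ x → c x ≡ k

-- A face permutation preserving opposite faces is a signed permutation matrix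
-- (column i is the image of +e_i); it is a rotation iff its determinant is +1.
nextAxis : Axis → Axis
nextAxis zero = suc zero
nextAxis (suc zero) = suc (suc zero)
nextAxis (suc (suc zero)) = zero

axisOf : Face → Axis
axisOf (a , _) = a

signOf : Face → Bool
signOf (_ , s) = s

-- determinant of the signed permutation matrix of f is +1:
-- sgn(axis permutation) * product of signs = +1.
-- The axis permutation (a0,a1,a2) of Fin 3 is even iff a1 = a0 + 1 (mod 3);
-- the product of signs is -1 iff an odd number of signs are negative.
detPositive : (Face → Face) → Set
detPositive f =
  isYes (axisOf (f (suc zero , true)) ≟ nextAxis (axisOf (f (zero , true))))
  ≡ not ((not (signOf (f (zero , true))) xor not (signOf (f (suc zero , true))))
           xor not (signOf (f (suc (suc zero) , true))))

IsRotation : (Face → Face) → Set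
IsRotation f = Injective _≡_ _≡_ f × ((x : Face) → f (opp x) ≡ opp (f x)) × detPositive f

SameVariety : Coloring → Coloring → Set
SameVariety c d = Σ (Face → Face) λ f → IsRotation f × ((x : Face) → d x ≡ c (f x))

reflect : Face → Face
reflect (zero , s) = (zero , not s)
reflect (suc a , s) = (suc a , s)

mirror : Coloring → Coloring
mirror c x = c (reflect x)

-- {p , q} is an opposite pair of c (symmetric in p, q via x ↦ opp x).
HasOppositePair : Coloring → Color → Color → Set
HasOppositePair c p q = ∃ λ x → (c x ≡ p) × (c (opp x) ≡ q)

-- The eight corner positions of the 2×2×2 cube; coordinate true = positive half.
Pos : Set
Pos = Bool × Bool × Bool

coord : Pos → Axis → Bool
coord (b , _ , _) zero = b
coord (_ , b , _) (suc zero) = b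
coord (_ , _ , b) (suc (suc zero)) = b

-- The eight cubes x can be assembled into a corner solution modeled on c:
-- cube i goes to corner (to π i), in orientation o i (a rotation of x i);
-- the outer faces of the small cube at corner p are the faces (a , coord p a);
-- each big face (a , s) is monochromatic of colour B (a , s); B is of variety c.
CornerSolutionModeledOn : Vec Coloring 8 → Coloring → Set
CornerSolutionModeledOn x c =
  Σ (Fin 8 ↔ Pos) λ π →
  Σ (Fin 8 → Coloring) λ o →
  Σ Coloring λ B →
    ((i : Fin 8) → SameVariety (lookup x i) (o i))
    × ((i : Fin 8) (a : Axis) →
         o i (a , coord (Inverse.to π i) a) ≡ B (a , coord (Inverse.to π i) a))
    × SameVariety c B

-- Rotate c so that p, q sit on the faces +x, -x; call the result B.  Every
-- other cube d with opposite pair {p, q} can be rotated the same way, and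
-- then d = B ∘ τ for a permutation τ of the faces fixing ±x.  Up to a
-- rotation, τ is one of six representatives (`rep`): the identity (d is c),
-- the mirror (d is c*), or one of four belt rearrangements N w labelled by
-- w ∈ 𝔹² (a "column" of corners).  The cube B ∘ N w fits, suitably rotated,
-- at both corners (true, w) and (false, w) of the big cube, while c fits
-- everywhere.
module Submission where

open import Defs
open import Data.Product using (_×_)
open import Data.Vec using (_∷_; [])
open import Relation.Nullary using (¬_)

open import Data.Bool using (Bool; true; false)
import Data.Bool.Properties as Bool
open import Data.Empty using (⊥-elim)
open import Data.Fin using (Fin; zero; suc; punchOut)
open import Data.Fin.Patterns using (0F; 1F; 2F; 3F; 4F; 5F; 6F; 7F)
open import Data.Fin.Permutation using (Permutation′; _⟨$⟩ʳ_; _∘ₚ_)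
  renaming (transpose to transposition)
open import Data.Fin.Permutation.Components using (transpose; transpose-inverse)
import Data.Fin.Properties as Fin
open import Data.Nat using (ℕ)
open import Data.Nat.Properties using (1+n≰n)
open import Data.Product using (Σ; ∃; _,_; proj₁; proj₂)
open import Data.Product.Algebra using (×-comm)
open import Data.Product.Function.NonDependent.Propositional using (_×-↔_)
import Data.Product.Properties as Product
open import Data.Sum using (inj₁; inj₂)
open import Data.Vec using (Vec; lookup)
open import Function using (_∘_; id)
open import Function.Bundles using (_↔_; Inverse)
open import Function.Construct.Composition using (_↔-∘_)
open import Function.Construct.Identity using (↔-id)
open import Function.Definitions using (Injective)
open import Relation.Binary.Definitions using (DecidableEquality)
open import Relation.Binary.PropositionalEquality
open import Relation.Nullary using (Dec; yes; no)
open import Relation.Nullary.Decidable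
  using (¬?; _×-dec_; _⊎-dec_; _→-dec_; map′; from-yes; dec-true; dec-false)
open import Relation.Unary using (Decidable)

pattern +x = (zero , true)
pattern -x = (zero , false)
pattern +y = (suc zero , true)
pattern -y = (suc zero , false)
pattern +z = (suc (suc zero) , true)
pattern -z = (suc (suc zero) , false)

_≟ᶠ_ : DecidableEquality Face
_≟ᶠ_ = Product.≡-dec Fin._≟_ Bool._≟_

all-bool? : {P : Bool → Set} → Decidable P → Dec (∀ b → P b)
all-bool? P? = map′ (λ { (t , f) true → t ; (t , f) false → f }) (λ h → h true , h false)
  (P? true ×-dec P? false)

any-bool? : {P : Bool → Set} → Decidable P → Dec (∃ P)
any-bool? P? = map′ (λ { (inj₁ p) → true , p ; (inj₂ p) → false , p })
  (λ { (true , p) → inj₁ p ; (false , p) → inj₂ p }) (P? true ⊎-dec P? false)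

all-faces? : {P : Face → Set} → Decidable P → Dec (∀ x → P x)
all-faces? P? = map′ (λ h (a , s) → h a s) (λ h a s → h (a , s))
  (Fin.all? λ a → all-bool? λ s → P? (a , s))

any-face? : {P : Face → Set} → Decidable P → Dec (∃ P)
any-face? P? = map′ (λ { (a , s , p) → (a , s) , p }) (λ { ((a , s) , p) → a , s , p })
  (Fin.any? λ a → any-bool? λ s → P? (a , s))

injective? : (f : Face → Face) → Dec (Injective _≡_ _≡_ f)
injective? f = map′ (λ h {x} {y} → h x y) (λ h x y → h)
  (all-faces? λ x → all-faces? λ y → (f x ≟ᶠ f y) →-dec (x ≟ᶠ y))

opp-involutive : ∀ x → opp (opp x) ≡ x
opp-involutive (a , s) = cong (a ,_) (Bool.not-involutive s)

reflect-involutive : ∀ x → reflect (reflect x) ≡ x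
reflect-involutive (zero , s) = cong (zero ,_) (Bool.not-involutive s)
reflect-involutive (suc a , s) = refl

reflect-opp : ∀ x → reflect (opp x) ≡ opp (reflect x)
reflect-opp (zero , s) = refl
reflect-opp (suc a , s) = refl

-- A face map commuting with `opp` is determined by its frame, the images
-- of +x, +y, +z.  This reduces every statement about all rotations to a
-- check over the 216 frames, done below by evaluation.

Frame : Set
Frame = Face × Face × Face

frame : (Face → Face) → Frame
frame f = f +x , f +y , f +z

column : Frame → Axis → Face
column (u , v , w) zero = u
column (u , v , w) (suc zero) = v
column (u , v , w) (suc (suc zero)) = w

linear : Frame → Face → Face
linear m (a , true) = column m a
linear m (a , false) = opp (column m a)

linear-opp : ∀ m x → linear m (opp x) ≡ opp (linear m x)
linear-opp m (a , true) = refl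
linear-opp m (a , false) = sym (opp-involutive (column m a))

OppositePreserving : (Face → Face) → Set
OppositePreserving f = ∀ x → f (opp x) ≡ opp (f x)

linear-frame : ∀ {f} → OppositePreserving f → ∀ x → f x ≡ linear (frame f) x
linear-frame h +x = refl
linear-frame h +y = refl
linear-frame h +z = refl
linear-frame h -x = h +x
linear-frame h -y = h +y
linear-frame h -z = h +z

Orthogonal : Frame → Set
Orthogonal (u , v , w) =
  ¬ axisOf u ≡ axisOf v × ¬ axisOf u ≡ axisOf w × ¬ axisOf v ≡ axisOf w

IsRotationFrame : Frame → Set
IsRotationFrame m = Orthogonal m × detPositive (linear m)

all-frames? : {P : Frame → Set} → Decidable P → Dec (∀ m → P m)
all-frames? P? = map′ (λ h (u , v , w) → h u v w) (λ h u v w → h (u , v , w))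
  (all-faces? λ u → all-faces? λ v → all-faces? λ w → P? (u , v , w))

any-frame? : {P : Frame → Set} → Decidable P → Dec (∃ P)
any-frame? P? = map′ (λ { (u , v , w , p) → (u , v , w) , p }) (λ { ((u , v , w) , p) → u , v , w , p })
  (any-face? λ u → any-face? λ v → any-face? λ w → P? (u , v , w))

detPositive? : (f : Face → Face) → Dec (detPositive f)
detPositive? f = _ Bool.≟ _

orthogonal? : (m : Frame) → Dec (Orthogonal m)
orthogonal? (u , v , w) =
  ¬? (axisOf u Fin.≟ axisOf v) ×-dec ¬? (axisOf u Fin.≟ axisOf w) ×-dec ¬? (axisOf v Fin.≟ axisOf w)

isRotationFrame? : (m : Frame) → Dec (IsRotationFrame m)
isRotationFrame? m = orthogonal? m ×-dec detPositive? (linear m)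

-- The determinant condition only reads the frame.
det-resp : ∀ {f g} → (∀ x → f x ≡ g x) → detPositive f → detPositive g
det-resp e = subst (detPositive ∘ linear)
  (cong₂ _,_ (e +x) (cong₂ _,_ (e +y) (e +z)))

opaque
  orthogonal⇒injective : ∀ m → Orthogonal m → Injective _≡_ _≡_ (linear m)
  orthogonal⇒injective = from-yes (all-frames? λ m → orthogonal? m →-dec injective? (linear m))

  injective⇒orthogonal : ∀ m → Injective _≡_ _≡_ (linear m) → Orthogonal m
  injective⇒orthogonal = from-yes (all-frames? λ m → injective? (linear m) →-dec orthogonal? m)

  frame-composition : ∀ m → IsRotationFrame m → ∀ m' → IsRotationFrame m' →
                      detPositive (linear m ∘ linear m')
  frame-composition = from-yes (all-frames? λ m → isRotationFrame? m →-dec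
    all-frames? λ m' → isRotationFrame? m' →-dec detPositive? (linear m ∘ linear m'))

  frame-inverse : ∀ m → IsRotationFrame m →
                  ∃ λ m' → IsRotationFrame m' × (∀ x → linear m (linear m' x) ≡ x)
  frame-inverse = from-yes (all-frames? λ m → isRotationFrame? m →-dec any-frame? λ m' →
    isRotationFrame? m' ×-dec all-faces? λ x → linear m (linear m' x) ≟ᶠ x)

  frame-mirror : ∀ m → IsRotationFrame m → detPositive (reflect ∘ linear m ∘ reflect)
  frame-mirror = from-yes (all-frames? λ m → isRotationFrame? m →-dec
    detPositive? (reflect ∘ linear m ∘ reflect))

  frame-to-face : ∀ x → ∃ λ m → IsRotationFrame m × linear m +x ≡ x
  frame-to-face = from-yes (all-faces? λ x → any-frame? λ m →
    isRotationFrame? m ×-dec (linear m +x ≟ᶠ x))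

frame-rotation : ∀ {m} → IsRotationFrame m → IsRotation (linear m)
frame-rotation {m} (orth , det) = orthogonal⇒injective m orth , linear-opp m , det

rotation-frame : ∀ {f} → IsRotation f → IsRotationFrame (frame f)
rotation-frame {f} (inj , opp-pres , det) =
  injective⇒orthogonal (frame f) linear-injective , det
  where
  linear-injective : Injective _≡_ _≡_ (linear (frame f))
  linear-injective {x} {y} e =
    inj (trans (linear-frame opp-pres x) (trans e (sym (linear-frame opp-pres y))))

rotation-id : IsRotation id
rotation-id = id , (λ x → refl) , refl

rotation-∘ : ∀ {f g} → IsRotation f → IsRotation g → IsRotation (f ∘ g)
rotation-∘ {f} {g} rf@(inj-f , opp-f , _) rg@(inj-g , opp-g , _) =
  inj-g ∘ inj-f ,
  (λ x → trans (cong f (opp-g x)) (opp-f (g x))) ,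
  det-resp as-linear (frame-composition (frame f) (rotation-frame rf) (frame g) (rotation-frame rg))
  where
  as-linear : ∀ x → linear (frame f) (linear (frame g) x) ≡ f (g x)
  as-linear x = trans (cong (linear (frame f)) (sym (linear-frame opp-g x)))
                      (sym (linear-frame opp-f (g x)))

rotation-inverse : ∀ {f} → IsRotation f → Σ (Face → Face) λ g → IsRotation g × (∀ x → f (g x) ≡ x)
rotation-inverse {f} rf@(_ , opp-f , _) =
  let m' , rot-m' , inverse = frame-inverse (frame f) (rotation-frame rf)
  in linear m' , frame-rotation rot-m' , λ x → trans (linear-frame opp-f (linear m' x)) (inverse x)

rotation-mirror : ∀ {f} → IsRotation f → IsRotation (reflect ∘ f ∘ reflect)
rotation-mirror {f} rf@(inj , opp-f , _) =
  (λ e → reflect-injective (inj (reflect-injective e))) ,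
  (λ x → begin
    reflect (f (reflect (opp x)))  ≡⟨ cong (reflect ∘ f) (reflect-opp x) ⟩
    reflect (f (opp (reflect x)))  ≡⟨ cong reflect (opp-f (reflect x)) ⟩
    reflect (opp (f (reflect x)))  ≡⟨ reflect-opp (f (reflect x)) ⟩
    opp (reflect (f (reflect x)))  ∎) ,
  det-resp as-linear (frame-mirror (frame f) (rotation-frame rf))
  where
  open ≡-Reasoning
  reflect-injective : Injective _≡_ _≡_ reflect
  reflect-injective {x} {y} e =
    trans (sym (reflect-involutive x)) (trans (cong reflect e) (reflect-involutive y))
  as-linear : ∀ x → reflect (linear (frame f) (reflect x)) ≡ reflect (f (reflect x))
  as-linear x = cong reflect (sym (linear-frame opp-f (reflect x)))

rotation-to-face : ∀ x → Σ (Face → Face) λ g → IsRotation g × g +x ≡ x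
rotation-to-face x = let m , rot-m , m+x = frame-to-face x in linear m , frame-rotation rot-m , m+x

variety-refl : ∀ {c} → SameVariety c c
variety-refl {c} = id , rotation-id , λ x → refl

variety-sym : ∀ {c d} → SameVariety c d → SameVariety d c
variety-sym {c} {d} (f , rf , d≡cf) =
  let g , rg , fg = rotation-inverse rf
  in g , rg , λ x → trans (cong c (sym (fg x))) (sym (d≡cf (g x)))

variety-trans : ∀ {c d e} → SameVariety c d → SameVariety d e → SameVariety c e
variety-trans {c} (f , rf , d≡cf) (g , rg , e≡dg) =
  f ∘ g , rotation-∘ rf rg , λ x → trans (e≡dg x) (d≡cf (g x))

variety-mirror : ∀ {c d} → SameVariety c d → SameVariety (mirror c) (mirror d)
variety-mirror {c} {d} (f , rf , d≡cf) =
  reflect ∘ f ∘ reflect , rotation-mirror rf ,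
  λ x → trans (d≡cf (reflect x)) (cong c (sym (reflect-involutive (f (reflect x)))))

colored-resp : ∀ {c d} → SameVariety c d → IsColoredCube c → IsColoredCube d
colored-resp {c} {d} c~d sc k =
  let f , _ , c≡df = variety-sym {c} {d} c~d
      x , cx = sc k
  in f x , trans (sym (c≡df x)) cx

face-code : Fin 6 ↔ Face
face-code = (↔-id _ ×-↔ Fin.2↔Bool) ↔-∘ Fin.*↔× {3} {2}

opaque
  injective⇒surjective : ∀ {n} (h : Fin n → Fin n) → Injective _≡_ _≡_ h →
                         ∀ y → ∃ λ k → h k ≡ y
  injective⇒surjective {ℕ.suc n} h inj y with Fin.any? (λ k → h k Fin.≟ y)
  ... | yes hit = hit
  ... | no miss = ⊥-elim (1+n≰n (Fin.injective⇒≤ squeeze-injective))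
    where
    -- h, with the value y it misses removed from its codomain
    squeeze : Fin (ℕ.suc n) → Fin n
    squeeze k = punchOut {i = y} {j = h k} (λ e → miss (k , sym e))
    squeeze-injective : Injective _≡_ _≡_ squeeze
    squeeze-injective {a} {b} e =
      inj (Fin.punchOut-injective (λ e′ → miss (a , sym e′)) (λ e′ → miss (b , sym e′)) e)

opaque
  surjection-inverse : ∀ {n} {A : Set} (code : Fin n ↔ A) {c : A → Fin n} → (∀ k → ∃ λ x → c x ≡ k) →
                       Σ (Fin n → A) λ u → (∀ k → c (u k) ≡ k) × (∀ x → u (c x) ≡ x)
  surjection-inverse {n} {A} code {c} surj = u , cu , uc
    where
    open Inverse code using (to; from; strictlyInverseˡ)
    u : Fin n → A
    u k = proj₁ (surj k)
    cu : ∀ k → c (u k) ≡ k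
    cu k = proj₂ (surj k)
    -- u is injective, hence so is its encoding from ∘ u : Fin n → Fin n
    coded-injective : Injective _≡_ _≡_ (from ∘ u)
    coded-injective {k} {l} e = trans (sym (cu k))
      (trans (cong c (trans (sym (strictlyInverseˡ (u k))) (trans (cong to e) (strictlyInverseˡ (u l)))))
             (cu l))
    -- ... so every x is some u k, and then u (c x) = u (c (u k)) = u k = x.
    uc : ∀ x → u (c x) ≡ x
    uc x with injective⇒surjective (from ∘ u) coded-injective (from x)
    ... | k , codes-agree = trans (cong (u ∘ c) (sym uk≡x)) (trans (cong u (cu k)) uk≡x)
      where
      uk≡x : u k ≡ x
      uk≡x = trans (sym (strictlyInverseˡ (u k))) (trans (cong to codes-agree) (strictlyInverseˡ x))

  colored-inverse : ∀ {c} → IsColoredCube c →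
                    Σ (Color → Face) λ u → (∀ k → c (u k) ≡ k) × (∀ x → u (c x) ≡ x)
  colored-inverse = surjection-inverse face-code

  colored-injective : ∀ {c} → IsColoredCube c → Injective _≡_ _≡_ c
  colored-injective {c} sc {x} {y} e = trans (sym (uc x)) (trans (cong u e) (uc y))
    where
    u : Color → Face
    u = proj₁ (colored-inverse sc)
    uc : ∀ x → u (c x) ≡ x
    uc = proj₂ (proj₂ (colored-inverse sc))

normal-position : ∀ {c p q} → HasOppositePair c p q →
                  Σ Coloring λ c' → SameVariety c c' × c' +x ≡ p × c' -x ≡ q
normal-position {c} (y , cy , cy') =
  let g , rg , g+x = rotation-to-face y
      _ , opp-g , _ = rg
  in c ∘ g , (g , rg , λ x → refl) , trans (cong c g+x) cy ,
     trans (cong c (trans (opp-g +x) (cong opp g+x))) cy'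

-- A column of corners of the big cube: the signs of the y and z coordinates.
W : Set
W = Bool × Bool

-- The four rearrangements of the faces -y, +z, -z other than the identity
-- and the swap of ±z (a mirror image); N w is the one fitting column w.
N : W → Face → Face
N (true , false) -y = +z
N (true , false) +z = -y
N (true , true) -y = -z
N (true , true) -z = -y
N (false , true) -y = +z
N (false , true) +z = -z
N (false , true) -z = -y
N (false , false) -y = -z
N (false , false) +z = -y
N (false , false) -z = +z
N w x = x

-- The six kinds: c itself, its mirror image, or an exotic kind per column.
data Kind : Set where
  same mirrored : Kind
  other : W → Kind

rep : Kind → Face → Face
rep same = id
rep mirrored = reflect
rep (other w) = N w

any-kind? : {P : Kind → Set} → Decidable P → Dec (∃ P)
any-kind? P? = map′
  (λ { (inj₁ p) → same , p ; (inj₂ (inj₁ p)) → mirrored , p ; (inj₂ (inj₂ (a , b , p))) → other (a , b) , p })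
  (λ { (same , p) → inj₁ p ; (mirrored , p) → inj₂ (inj₁ p) ; (other (a , b) , p) → inj₂ (inj₂ (a , b , p)) })
  (P? same ⊎-dec P? mirrored ⊎-dec any-bool? λ a → any-bool? λ b → P? (other (a , b)))

Classified : (Face → Face) → Set
Classified τ = Σ Kind λ k → Σ Frame λ m → IsRotationFrame m × (∀ x → τ x ≡ rep k (linear m x))

tabulate : Face → Face → Face → Face → Face → Face → Face → Face
tabulate a b c d e f +x = a
tabulate a b c d e f -x = b
tabulate a b c d e f +y = c
tabulate a b c d e f -y = d
tabulate a b c d e f +z = e
tabulate a b c d e f -z = f

tabulate-self : ∀ (τ : Face → Face) x → τ x ≡ tabulate (τ +x) (τ -x) (τ +y) (τ -y) (τ +z) (τ -z) x
tabulate-self τ +x = refl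
tabulate-self τ -x = refl
tabulate-self τ +y = refl
tabulate-self τ -y = refl
tabulate-self τ +z = refl
tabulate-self τ -z = refl

opaque
  classify-table : ∀ c d e f → Injective _≡_ _≡_ (tabulate +x -x c d e f) →
                   Classified (tabulate +x -x c d e f)
  classify-table = from-yes (all-faces? λ c → all-faces? λ d → all-faces? λ e → all-faces? λ f →
    let τ = tabulate +x -x c d e f in
    injective? τ →-dec any-kind? λ k → any-frame? λ m →
      isRotationFrame? m ×-dec all-faces? λ x → τ x ≟ᶠ rep k (linear m x))

belt-table : ∀ τ → τ +x ≡ +x → τ -x ≡ -x →
             ∀ x → τ x ≡ tabulate +x -x (τ +y) (τ -y) (τ +z) (τ -z) x
belt-table τ τ+x τ-x x =
  subst₂ (λ a b → τ x ≡ tabulate a b (τ +y) (τ -y) (τ +z) (τ -z) x) τ+x τ-x (tabulate-self τ x)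

classify : ∀ τ → Injective _≡_ _≡_ τ → τ +x ≡ +x → τ -x ≡ -x → Classified τ
classify τ inj τ+x τ-x =
  let k , m , rot-m , table≡ = classify-table (τ +y) (τ -y) (τ +z) (τ -z) table-injective
  in k , m , rot-m , λ x → trans (τ≡table x) (table≡ x)
  where
  τ≡table : ∀ x → τ x ≡ tabulate +x -x (τ +y) (τ -y) (τ +z) (τ -z) x
  τ≡table = belt-table τ τ+x τ-x
  table-injective : Injective _≡_ _≡_ (tabulate +x -x (τ +y) (τ -y) (τ +z) (τ -z))
  table-injective {x} {y} e = inj (trans (τ≡table x) (trans e (sym (τ≡table y))))

belt-classification : ∀ {B d} → IsColoredCube B → IsColoredCube d →
                      d +x ≡ B +x → d -x ≡ B -x → Σ Kind λ k → SameVariety (B ∘ rep k) d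
belt-classification {B} {d} sB sd d+x d-x =
  let k , m , rot-m , τ≡ = classify (u ∘ d) τ-injective
                               (trans (cong u d+x) (uB +x)) (trans (cong u d-x) (uB -x))
  in k , linear m , frame-rotation rot-m , λ x → trans (sym (Bu (d x))) (cong B (τ≡ x))
  where
  -- d = B ∘ τ for the face permutation τ = u ∘ d, which fixes ±x.
  u : Color → Face
  u = proj₁ (colored-inverse sB)
  Bu : ∀ k → B (u k) ≡ k
  Bu = proj₁ (proj₂ (colored-inverse sB))
  uB : ∀ x → u (B x) ≡ x
  uB = proj₂ (proj₂ (colored-inverse sB))
  τ-injective : Injective _≡_ _≡_ (u ∘ d)
  τ-injective {x} {y} e = colored-injective sd (trans (sym (Bu (d x))) (trans (cong B e) (Bu (d y))))

Fits : Coloring → Coloring → Pos → Set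
Fits B d P = Σ Coloring λ o → SameVariety d o × (∀ a → o (a , coord P a) ≡ B (a , coord P a))

fits-resp : ∀ {B d e P} → SameVariety d e → Fits B d P → Fits B e P
fits-resp {d = d} {e} d~e (o , d~o , agree) =
  o , variety-trans {e} {d} {o} (variety-sym {d} {e} d~e) d~o , agree

fits-self : ∀ {B P} → Fits B B P
fits-self {B} = B , variety-refl {B} , λ a → refl

opaque
  column-frame : ∀ b w₁ w₂ → ∃ λ m → IsRotationFrame m ×
    (∀ a → N (w₁ , w₂) (linear m (a , coord (b , w₁ , w₂) a)) ≡ (a , coord (b , w₁ , w₂) a))
  column-frame = from-yes (all-bool? λ b → all-bool? λ w₁ → all-bool? λ w₂ → any-frame? λ m →
    isRotationFrame? m ×-dec Fin.all? λ a →
      N (w₁ , w₂) (linear m (a , coord (b , w₁ , w₂) a)) ≟ᶠ (a , coord (b , w₁ , w₂) a))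

fits-column : ∀ {B} b w → Fits B (B ∘ N w) (b , w)
fits-column {B} b (w₁ , w₂) =
  let m , rot-m , match = column-frame b w₁ w₂
  in B ∘ N (w₁ , w₂) ∘ linear m , (linear m , frame-rotation rot-m , λ x → refl) , λ a → cong B (match a)

transpose-hit : ∀ {n} (i j : Fin n) → transpose i j i ≡ j
transpose-hit i j rewrite dec-true (i Fin.≟ i) refl = refl

transpose-miss : ∀ {n} {i j k : Fin n} → k ≢ i → k ≢ j → transpose i j k ≡ k
transpose-miss {i = i} {j} {k} k≢i k≢j
  rewrite dec-false (k Fin.≟ i) k≢i | dec-false (k Fin.≟ j) k≢j = refl

two-point : ∀ {n} {i j u v : Fin n} → i ≢ j → u ≢ v →
            Σ (Permutation′ n) λ σ → σ ⟨$⟩ʳ i ≡ u × σ ⟨$⟩ʳ j ≡ v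
two-point {i = i} {j} {u} {v} i≢j u≢v =
  transposition i u ∘ₚ transposition j′ v ,
  trans (cong (transpose j′ v) (transpose-hit i u)) (transpose-miss u≢j′ u≢v) ,
  transpose-hit j′ v
  where
  j′ : Fin _
  j′ = transpose i u j
  -- transpose i u is injective, and sends i to u
  u≢j′ : u ≢ j′
  u≢j′ u≡j′ = i≢j (begin
    i                                ≡⟨ sym (transpose-inverse u i) ⟩
    transpose u i (transpose i u i)  ≡⟨ cong (transpose u i) (trans (transpose-hit i u) u≡j′) ⟩
    transpose u i (transpose i u j)  ≡⟨ transpose-inverse u i ⟩
    j                                ∎)
    where open ≡-Reasoning

opaque
  prescribe-two : ∀ {n} {A : Set} (code : Fin n ↔ A) {i j : Fin n} {u v : A} → i ≢ j → u ≢ v →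
                  Σ (Fin n ↔ A) λ π → Inverse.to π i ≡ u × Inverse.to π j ≡ v
  prescribe-two code {u = u} {v} i≢j u≢v =
    let σ , σi , σj = two-point i≢j (λ e → u≢v (from-injective e))
    in code ↔-∘ σ , trans (cong to σi) (strictlyInverseˡ u) , trans (cong to σj) (strictlyInverseˡ v)
    where
    open Inverse code using (to; from; strictlyInverseˡ)
    from-injective : from u ≡ from v → u ≡ v
    from-injective e = trans (sym (strictlyInverseˡ u)) (trans (cong to e) (strictlyInverseˡ v))

W-code : Fin 4 ↔ W
W-code = (Fin.2↔Bool ×-↔ Fin.2↔Bool) ↔-∘ Fin.*↔× {2} {2}

-- Cube k ∈ Fin 8 with k = 2·l + b goes to the corner (b, σ l).
corner-layout : Fin 4 ↔ W → Fin 8 ↔ Pos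
corner-layout σ = ×-comm _ _ ↔-∘ ((σ ×-↔ Fin.2↔Bool) ↔-∘ Fin.*↔× {4} {2})

assemble : ∀ {c B} (π : Fin 8 ↔ Pos) (cubes : Vec Coloring 8) → SameVariety c B →
           (∀ i → Fits B (lookup cubes i) (Inverse.to π i)) → CornerSolutionModeledOn cubes c
assemble {B = B} π cubes c~B fits =
  π , (λ i → proj₁ (fits i)) , B , (λ i → proj₁ (proj₂ (fits i))) , (λ i → proj₂ (proj₂ (fits i))) , c~B

module Corners (p q : Color) (c : Coloring) (sc : IsColoredCube c) (cpq : HasOppositePair c p q) where

  B : Coloring
  B = proj₁ (normal-position cpq)

  c~B : SameVariety c B
  c~B = proj₁ (proj₂ (normal-position cpq))

  B+x : B +x ≡ p
  B+x = proj₁ (proj₂ (proj₂ (normal-position cpq)))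

  B-x : B -x ≡ q
  B-x = proj₂ (proj₂ (proj₂ (normal-position cpq)))

  fits-c : ∀ {P} → Fits B c P
  fits-c {P} = fits-resp {B} {B} {c} {P} (variety-sym {c} {B} c~B) (fits-self {B})

  opaque
    kind : ∀ {d} → IsColoredCube d → HasOppositePair d p q → Σ Kind λ k → SameVariety (B ∘ rep k) d
    kind {d} sd dpq =
      let d′ , d~d′ , d′+x , d′-x = normal-position dpq
          k , K~d′ = belt-classification {B} {d′} (colored-resp {c} {B} c~B sc) (colored-resp {d} {d′} d~d′ sd)
                                         (trans d′+x (sym B+x)) (trans d′-x (sym B-x))
      in k , variety-trans {B ∘ rep k} {d′} {d} K~d′ (variety-sym {d} {d′} d~d′)

  mirror-c-variety : ∀ {d} → SameVariety (B ∘ reflect) d → SameVariety (mirror c) d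
  mirror-c-variety {d} = variety-trans {mirror c} {mirror B} {d} (variety-mirror {c} {B} c~B)

  exotic : ∀ {d} → ¬ SameVariety c d → ¬ SameVariety (mirror c) d →
           Σ Kind (λ k → SameVariety (B ∘ rep k) d) → Σ W λ w → SameVariety (B ∘ N w) d
  exotic {d} c≁d c*≁d (same , B~d) = ⊥-elim (c≁d (variety-trans {c} {B} {d} c~B B~d))
  exotic {d} c≁d c*≁d (mirrored , B*~d) = ⊥-elim (c*≁d (mirror-c-variety {d} B*~d))
  exotic c≁d c*≁d (other w , K~d) = w , K~d

  column-of : ∀ {d} → ¬ SameVariety (mirror c) d →
              Σ Kind (λ k → SameVariety (B ∘ rep k) d) → Σ W λ w → ∀ b → Fits B d (b , w)
  column-of {d} c*≁d (same , B~d) = (true , true) , λ b → fits-resp {B} {B} {d} B~d (fits-self {B})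
  column-of {d} c*≁d (mirrored , B*~d) = ⊥-elim (c*≁d (mirror-c-variety {d} B*~d))
  column-of {d} c*≁d (other w , K~d) = w , λ b → fits-resp {B} {B ∘ N w} {d} K~d (fits-column {B} b w)

  distinct-columns : ∀ {d e wd we} → ¬ SameVariety d e →
                     SameVariety (B ∘ N wd) d → SameVariety (B ∘ N we) e → wd ≢ we
  distinct-columns {d} {e} {wd} d≁e Kd~d Ke~e refl =
    d≁e (variety-trans {d} {B ∘ N wd} {e} (variety-sym {B ∘ N wd} {d} Kd~d) Ke~e)

  two-columns : ∀ {d e wd we} → wd ≢ we → (∀ b → Fits B d (b , wd)) → (∀ b → Fits B e (b , we)) →
                CornerSolutionModeledOn (c ∷ c ∷ c ∷ c ∷ d ∷ d ∷ e ∷ e ∷ []) c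
  two-columns {d} {e} {wd} {we} wd≢we fits-d fits-e =
    assemble {c} {B} π (c ∷ c ∷ c ∷ c ∷ d ∷ d ∷ e ∷ e ∷ []) c~B slot
    where
    prescribed : Σ (Fin 4 ↔ W) λ σ → Inverse.to σ 2F ≡ wd × Inverse.to σ 3F ≡ we
    prescribed = prescribe-two W-code {2F} {3F} (λ ()) wd≢we
    π : Fin 8 ↔ Pos
    π = corner-layout (proj₁ prescribed)
    at-d : ∀ b → Fits B d (b , Inverse.to (proj₁ prescribed) 2F)
    at-d b = subst (λ w → Fits B d (b , w)) (sym (proj₁ (proj₂ prescribed))) (fits-d b)
    at-e : ∀ b → Fits B e (b , Inverse.to (proj₁ prescribed) 3F)
    at-e b = subst (λ w → Fits B e (b , w)) (sym (proj₂ (proj₂ prescribed))) (fits-e b)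
    slot : ∀ i → Fits B (lookup (c ∷ c ∷ c ∷ c ∷ d ∷ d ∷ e ∷ e ∷ []) i) (Inverse.to π i)
    slot 0F = fits-c
    slot 1F = fits-c
    slot 2F = fits-c
    slot 3F = fits-c
    slot 4F = at-d false
    slot 5F = at-d true
    slot 6F = at-e false
    slot 7F = at-e true

  two-corners : ∀ {f g wf wg} → Fits B f (true , wf) → Fits B g (false , wg) →
                CornerSolutionModeledOn (c ∷ c ∷ c ∷ c ∷ c ∷ c ∷ f ∷ g ∷ []) c
  two-corners {f} {g} {wf} {wg} fits-f fits-g =
    assemble {c} {B} (proj₁ prescribed) (c ∷ c ∷ c ∷ c ∷ c ∷ c ∷ f ∷ g ∷ []) c~B slot
    where
    prescribed : Σ (Fin 8 ↔ Pos) λ π → Inverse.to π 6F ≡ (true , wf) × Inverse.to π 7F ≡ (false , wg)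
    prescribed = prescribe-two (corner-layout W-code) {6F} {7F} {true , wf} {false , wg} (λ ()) (λ ())
    slot : ∀ i → Fits B (lookup (c ∷ c ∷ c ∷ c ∷ c ∷ c ∷ f ∷ g ∷ []) i) (Inverse.to (proj₁ prescribed) i)
    slot 0F = fits-c
    slot 1F = fits-c
    slot 2F = fits-c
    slot 3F = fits-c
    slot 4F = fits-c
    slot 5F = fits-c
    slot 6F = subst (Fits B f) (sym (proj₁ (proj₂ prescribed))) fits-f
    slot 7F = subst (Fits B g) (sym (proj₂ (proj₂ prescribed))) fits-g

  part1 : ∀ d e → IsColoredCube d → IsColoredCube e → HasOppositePair d p q → HasOppositePair e p q →
          ¬ SameVariety d e → ¬ SameVariety c d → ¬ SameVariety (mirror c) d →
          ¬ SameVariety c e → ¬ SameVariety (mirror c) e →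
          CornerSolutionModeledOn (c ∷ c ∷ c ∷ c ∷ d ∷ d ∷ e ∷ e ∷ []) c
  part1 d e sd se dpq epq d≁e c≁d c*≁d c≁e c*≁e =
    let wd , Kd~d = exotic c≁d c*≁d (kind sd dpq)
        we , Ke~e = exotic c≁e c*≁e (kind se epq)
    in two-columns (distinct-columns d≁e Kd~d Ke~e)
                   (λ b → fits-resp {B} {B ∘ N wd} {d} Kd~d (fits-column {B} b wd))
                   (λ b → fits-resp {B} {B ∘ N we} {e} Ke~e (fits-column {B} b we))

  part2 : ∀ f g → IsColoredCube f → IsColoredCube g → HasOppositePair f p q → HasOppositePair g p q →
          ¬ SameVariety (mirror c) f → ¬ SameVariety (mirror c) g →
          CornerSolutionModeledOn (c ∷ c ∷ c ∷ c ∷ c ∷ c ∷ f ∷ g ∷ []) c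
  part2 f g sf sg fpq gpq c*≁f c*≁g =
    two-corners (proj₂ (column-of c*≁f (kind sf fpq)) true) (proj₂ (column-of c*≁g (kind sg gpq)) false)

corollary5p4 : (p q : Color) (c : Coloring) → IsColoredCube c → HasOppositePair c p q →
    ((d e : Coloring) → IsColoredCube d → IsColoredCube e →
      HasOppositePair d p q → HasOppositePair e p q →
      ¬ SameVariety d e →
      ¬ SameVariety c d → ¬ SameVariety (mirror c) d →
      ¬ SameVariety c e → ¬ SameVariety (mirror c) e →
      CornerSolutionModeledOn (c ∷ c ∷ c ∷ c ∷ d ∷ d ∷ e ∷ e ∷ []) c)
    ×
    ((f g : Coloring) → IsColoredCube f → IsColoredCube g →
      HasOppositePair f p q → HasOppositePair g p q →
      ¬ SameVariety (mirror c) f → ¬ SameVariety (mirror c) g →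
      CornerSolutionModeledOn (c ∷ c ∷ c ∷ c ∷ c ∷ c ∷ f ∷ g ∷ []) c)
corollary5p4 p q c sc cpq = Corners.part1 p q c sc cpq , Corners.part2 p q c sc cpq
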